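{- Let $k \geq 3$ be an odd integer. Then $h(n,k) \leq \frac{n(3k-1)}{12}$ for every positive integer $n$ with $n \equiv 0 \pmod{\frac{3(k-1)}{2}}$.
   Context: All graphs are finite and simple. A degree monotone path in a graph $G$ is a path $v_1v_2\ldots v_m$ such that $\deg(v_1)\le\cdots\le\deg(v_m)$ or $\deg(v_1)\ge\cdots\ge\deg(v_m)$, where degrees are taken in $G$. Its length is its number of vertices $m$. $mp(G)$ denotes the maximum length of a degree monotone path in $G$. For $k\ge 2$, a graph $G$ is called $k$-saturated if $mp(G)<k$ and $mp(G+e)\ge k$ for every edge $e$ joining two nonadjacent vertices of $G$, where $G+e$ is $G$ with $e$ added. In particular, every complete graph $K_m$ with $m\le k-1$ is $k$-saturated. $h(n,k)$ is the minimum number of edges of a $k$-saturated graph on $n$ vertices. -}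

module Defs where

open import Data.Nat using (ℕ; _+_; _≤_; _<_)
open import Data.Bool using (Bool; true; false; if_then_else_; _∨_; _∧_)
open import Data.Fin using (Fin)
import Data.Fin as F
open import Data.List using (List; length; map; allFin)
open import Data.Nat.ListAction using (sum)
open import Data.List.Relation.Unary.Linked using (Linked)
open import Data.List.Relation.Unary.Unique.Propositional using (Unique)
open import Data.Product using (_×_; ∃; ∃-syntax)
open import Data.Sum using (_⊎_)
open import Relation.Binary.PropositionalEquality using (_≡_)
open import Relation.Nullary using (¬_)
open import Relation.Nullary.Decidable using (⌊_⌋)

record Graph (n : ℕ) : Set where
  field
    adj    : Fin n → Fin n → Bool
    sym    : ∀ i j → adj i j ≡ adj j i
    irrefl : ∀ i → adj i i ≡ false
open Graph public

deg : ∀ {n} → Graph n → Fin n → ℕ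
deg {n} G i = sum (map (λ j → if adj G i j then 1 else 0) (allFin n))

edges : ∀ {n} → Graph n → ℕ
edges {n} G =
  sum (map (λ i → sum (map (λ j → if ⌊ i F.<? j ⌋ ∧ adj G i j then 1 else 0)
                           (allFin n)))
           (allFin n))

IsPath : ∀ {n} → Graph n → List (Fin n) → Set
IsPath G p = Unique p × Linked (λ u v → adj G u v ≡ true) p

IsDegMonotonePath : ∀ {n} → Graph n → List (Fin n) → Set
IsDegMonotonePath G p =
  IsPath G p ×
  (Linked (λ u v → deg G u ≤ deg G v) p ⊎ Linked (λ u v → deg G v ≤ deg G u) p)

MpLt : ∀ {n} → Graph n → ℕ → Set
MpLt G k = ∀ p → IsDegMonotonePath G p → length p < k

MpGe : ∀ {n} → Graph n → ℕ → Set
MpGe G k = ∃[ p ] (IsDegMonotonePath G p × k ≤ length p)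

addEdge : ∀ {n} → (G : Graph n) → (u v : Fin n) → ¬ (u ≡ v) → Graph n
addEdge {n} G u v u≢v = record { adj = a ; sym = s ; irrefl = r }
  where
  open import Relation.Binary.PropositionalEquality using (refl; cong₂; trans)
  open import Data.Bool.Properties using (∨-comm)
  open import Data.Fin.Properties using (_≟_)
  open import Relation.Nullary using (yes; no)
  isUV : Fin n → Fin n → Bool
  isUV i j = (⌊ i ≟ u ⌋ ∧ ⌊ j ≟ v ⌋) ∨ (⌊ i ≟ v ⌋ ∧ ⌊ j ≟ u ⌋)
  a : Fin n → Fin n → Bool
  a i j = adj G i j ∨ isUV i j
  isUV-sym : ∀ i j → isUV i j ≡ isUV j i
  isUV-sym i j with i ≟ u | j ≟ v | i ≟ v | j ≟ u
  ... | yes _ | yes _ | yes _ | yes _ = refl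
  ... | yes _ | yes _ | yes _ | no _ = refl
  ... | yes _ | yes _ | no _ | yes _ = refl
  ... | yes _ | yes _ | no _ | no _ = refl
  ... | yes _ | no _ | yes _ | yes _ = refl
  ... | yes _ | no _ | yes _ | no _ = refl
  ... | yes _ | no _ | no _ | yes _ = refl
  ... | yes _ | no _ | no _ | no _ = refl
  ... | no _ | yes _ | yes _ | yes _ = refl
  ... | no _ | yes _ | yes _ | no _ = refl
  ... | no _ | yes _ | no _ | yes _ = refl
  ... | no _ | yes _ | no _ | no _ = refl
  ... | no _ | no _ | yes _ | yes _ = refl
  ... | no _ | no _ | yes _ | no _ = refl
  ... | no _ | no _ | no _ | yes _ = refl
  ... | no _ | no _ | no _ | no _ = refl
  s : ∀ i j → a i j ≡ a j i
  s i j = cong₂ _∨_ (sym G i j) (isUV-sym i j)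
  isUV-irr : ∀ i → isUV i i ≡ false
  isUV-irr i with i ≟ u | i ≟ v
  ... | yes refl | yes refl = Data.Empty.⊥-elim (u≢v refl)
    where import Data.Empty
  ... | yes _ | no _ = refl
  ... | no _ | yes _ = refl
  ... | no _ | no _ = refl
  r : ∀ i → a i i ≡ false
  r i = trans (cong₂ _∨_ (irrefl G i) (isUV-irr i)) refl

Saturated : ∀ {n} → ℕ → Graph n → Set
Saturated k G =
  MpLt G k ×
  (∀ u v → (u≢v : ¬ (u ≡ v)) → adj G u v ≡ false → MpGe (addEdge G u v u≢v) k)

module Submission where

-- Write k = 2t + 1 and n = q · 3t.  The graph G consists of q blocks, each
-- made of three t-cliques (left, middle, right) with perfect matchings
-- joining the middle clique to both outer cliques; outer vertices have
-- degree t, middle ones t + 1, so 2|E(G)| = nt + qt and 12|E(G)| = n(3k − 1).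
-- mp(G) ≤ 2t: along a degree monotone path the vertices of equal degree form
-- one contiguous stretch, and two adjacent vertices of equal degree lie in a
-- common clique, so the path meets at most two cliques.  Saturation: adding
-- a non-edge uv raises the degrees of u and v by one, and in each of the
-- three cases (u, v outer / one outer, one middle / both middle) an explicit
-- non-decreasing path on 2t + 1 vertices climbs from an outer clique through
-- a middle clique to the new edge.

open import Defs hiding (sym; irrefl)
open import Data.Nat using (ℕ; zero; suc; _+_; _*_; _∸_; _/_; _%_; _≤_; _<_; z≤n; s≤s)
import Data.Nat as ℕ
open import Data.Nat.Properties hiding (_≟_)
open import Algebra.Properties.CommutativeSemigroup +-commutativeSemigroup using (interchange)
open import Data.Nat.DivMod using (m≡m%n+[m/n]*n; m*n/n≡m)
open import Data.Nat.Divisibility using (_∣_; divides)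
open import Data.Nat.ListAction using (sum)
open import Data.Nat.Solver using (module +-*-Solver)
open import Data.Bool using (Bool; true; false; if_then_else_; _∨_; _∧_; not)
open import Data.Bool.Properties using (∧-zeroʳ; ∧-identityʳ; ∨-zeroʳ; ∨-comm)
open import Data.Fin as Fin using (Fin; zero; suc; punchIn; combine; remQuot)
open import Data.Fin.Properties as FinP
  using (_≟_; punchIn-injective; punchInᵢ≢i; punchIn-punchOut; remQuot-combine; combine-remQuot)
open import Data.List using (List; []; _∷_; _++_; length; map; allFin; filter)
open import Data.List.Properties using (length-++; length-map; length-tabulate; filter-all)
open import Data.List.Membership.Propositional using (_∈_; _∉_)
open import Data.List.Membership.Propositional.Properties
  using (∈-allFin; ∈-map⁺; ∈-map⁻; ∈-filter⁻; ∈-++⁺ˡ; ∈-++⁺ʳ; ∈-++⁻)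
open import Data.List.Relation.Unary.Any using (here; there)
open import Data.List.Relation.Unary.All using (All; []; _∷_)
import Data.List.Relation.Unary.All as All
import Data.List.Relation.Unary.All.Properties as All
open import Data.List.Relation.Unary.AllPairs using (AllPairs; []; _∷_)
import Data.List.Relation.Unary.AllPairs.Properties as AllPairs
open import Data.List.Relation.Unary.Linked using (Linked; []; [-]; _∷_)
import Data.List.Relation.Unary.Linked as Linked
import Data.List.Relation.Unary.Linked.Properties as Linked
open import Data.List.Relation.Unary.Unique.Propositional using (Unique)
import Data.List.Relation.Unary.Unique.Propositional.Properties as Unique
open import Data.Product using (_×_; _,_; proj₁; proj₂; ∃-syntax)
open import Data.Sum using (_⊎_; inj₁; inj₂)
open import Data.Empty using (⊥; ⊥-elim)
open import Function using (case_of_; flip)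
open import Relation.Binary.PropositionalEquality
open import Relation.Binary.Definitions using (tri<; tri≈; tri>)
open import Relation.Nullary using (¬_; yes; no; Dec)
open import Relation.Nullary.Decidable using (⌊_⌋; ¬?; decidable-stable)

ind : Bool → ℕ
ind b = if b then 1 else 0

ind-injective : ∀ {a b} → ind a ≡ ind b → a ≡ b
ind-injective {false} {false} _ = refl
ind-injective {true}  {true}  _ = refl

module _ {A : Set} where

  sum-map-+ : ∀ (f g : A → ℕ) xs →
    sum (map (λ x → f x + g x) xs) ≡ sum (map f xs) + sum (map g xs)
  sum-map-+ f g []       = refl
  sum-map-+ f g (x ∷ xs) =
    trans (cong ((f x + g x) +_) (sum-map-+ f g xs)) (interchange (f x) (g x) _ _)

  sum-map-cong : ∀ {f g : A → ℕ} xs → (∀ x → x ∈ xs → f x ≡ g x) →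
    sum (map f xs) ≡ sum (map g xs)
  sum-map-cong []       _  = refl
  sum-map-cong (x ∷ xs) eq = cong₂ _+_ (eq x (here refl)) (sum-map-cong xs (λ y y∈ → eq y (there y∈)))

  sum-map-mono : ∀ {f g : A → ℕ} xs → (∀ x → x ∈ xs → f x ≤ g x) →
    sum (map f xs) ≤ sum (map g xs)
  sum-map-mono []       _  = z≤n
  sum-map-mono (x ∷ xs) le = +-mono-≤ (le x (here refl)) (sum-map-mono xs (λ y y∈ → le y (there y∈)))

  sum-map-const : ∀ c xs → sum (map (λ (_ : A) → c) xs) ≡ length xs * c
  sum-map-const c []       = refl
  sum-map-const c (x ∷ xs) = cong (c +_) (sum-map-const c xs)

  sum-map-zero : ∀ xs → sum (map (λ (_ : A) → 0) xs) ≡ 0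
  sum-map-zero []       = refl
  sum-map-zero (x ∷ xs) = sum-map-zero xs

  sum-swap : ∀ {B : Set} (g : A → B → ℕ) xs ys →
    sum (map (λ x → sum (map (g x) ys)) xs) ≡ sum (map (λ y → sum (map (λ x → g x y) xs)) ys)
  sum-swap g xs []       = sum-map-zero xs
  sum-swap g xs (y ∷ ys) =
    trans (sum-map-+ (λ x → g x y) (λ x → sum (map (g x) ys)) xs)
          (cong (sum (map (λ x → g x y) xs) +_) (sum-swap g xs ys))

length-allFin : ∀ n → length (allFin n) ≡ n
length-allFin n = length-tabulate {n = n} (λ i → i)

module _ {n : ℕ} where

  open import Data.List.Membership.DecPropositional (_≟_ {n}) using (_∈?_)

  occurrences : Fin n → List (Fin n) → ℕ
  occurrences a xs = sum (map (λ x → ind ⌊ x ≟ a ⌋) xs)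

  occurrences-∉ : ∀ {a} xs → a ∉ xs → occurrences a xs ≡ 0
  occurrences-∉ []       _  = refl
  occurrences-∉ {a} (x ∷ xs) a∉ with x ≟ a
  ... | yes refl = ⊥-elim (a∉ (here refl))
  ... | no  _    = occurrences-∉ xs (λ a∈ → a∉ (there a∈))

  occurrences-∈ : ∀ {a} xs → Unique xs → a ∈ xs → occurrences a xs ≡ 1
  occurrences-∈ {a} (x ∷ xs) (x∉xs ∷ _) (here refl) with x ≟ x
  ... | yes _ = cong suc (occurrences-∉ xs (λ x∈ → All.lookup x∉xs x∈ refl))
  ... | no x≢x = ⊥-elim (x≢x refl)
  occurrences-∈ {a} (x ∷ xs) (x∉xs ∷ u) (there a∈) with x ≟ a
  ... | yes refl = ⊥-elim (All.lookup x∉xs a∈ refl)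
  ... | no  _    = occurrences-∈ xs u a∈

  occurrences-allFin : ∀ a → occurrences a (allFin n) ≡ 1
  occurrences-allFin a = occurrences-∈ (allFin n) (Unique.allFin⁺ n) (∈-allFin a)

  count-members : ∀ L → Unique L → sum (map (λ j → ind ⌊ j ∈? L ⌋) (allFin n)) ≡ length L
  count-members []       _          = sum-map-zero (allFin n)
  count-members (x ∷ L) (x∉L ∷ uL) = begin
    sum (map (λ j → ind ⌊ j ∈? (x ∷ L) ⌋) (allFin n))
      ≡⟨ sum-map-cong (allFin n) (λ j _ → split j) ⟩
    sum (map (λ j → ind ⌊ j ≟ x ⌋ + ind ⌊ j ∈? L ⌋) (allFin n))
      ≡⟨ sum-map-+ (λ j → ind ⌊ j ≟ x ⌋) (λ j → ind ⌊ j ∈? L ⌋) (allFin n) ⟩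
    occurrences x (allFin n) + sum (map (λ j → ind ⌊ j ∈? L ⌋) (allFin n))
      ≡⟨ cong₂ _+_ (occurrences-allFin x) (count-members L uL) ⟩
    suc (length L) ∎
    where
    open ≡-Reasoning
    -- j ∈ x ∷ L iff j ≡ x or j ∈ L, and not both since x ∉ L
    split : ∀ j → ind ⌊ j ∈? (x ∷ L) ⌋ ≡ ind ⌊ j ≟ x ⌋ + ind ⌊ j ∈? L ⌋
    split j with j ∈? (x ∷ L) | j ≟ x | j ∈? L
    ... | _              | yes refl | yes j∈L = ⊥-elim (All.lookup x∉L j∈L refl)
    ... | yes _          | yes _    | no  _   = refl
    ... | yes (here j≡x) | no  j≢x  | _       = ⊥-elim (j≢x j≡x)
    ... | yes (there _)  | no  _    | yes _   = refl
    ... | yes (there j∈) | no  _    | no  j∉  = ⊥-elim (j∉ j∈)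
    ... | no  j∉         | yes j≡x  | _       = ⊥-elim (j∉ (here j≡x))
    ... | no  j∉         | no  _    | yes j∈  = ⊥-elim (j∉ (there j∈))
    ... | no  _          | no  _    | no  _   = refl

  count-by-list : (f : Fin n → Bool) (L : List (Fin n)) → Unique L →
    (∀ j → f j ≡ true → j ∈ L) → (∀ j → j ∈ L → f j ≡ true) →
    sum (map (λ j → ind (f j)) (allFin n)) ≡ length L
  count-by-list f L uL complete sound =
    trans (sum-map-cong (allFin n) (λ j _ → cong ind (agree j))) (count-members L uL)
    where
    agree : ∀ j → f j ≡ ⌊ j ∈? L ⌋
    agree j with j ∈? L | f j in fj
    ... | yes j∈ | false = trans (sym fj) (sound j j∈)
    ... | yes _  | true  = refl
    ... | no  _  | false = refl
    ... | no  j∉ | true  = ⊥-elim (j∉ (complete j fj))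

  subset-length : ∀ xs L → Unique xs → Unique L → (∀ {x} → x ∈ xs → x ∈ L) →
    length xs ≤ length L
  subset-length xs L uxs uL xs⊆L = begin
    length xs                                        ≡⟨ count-members xs uxs ⟨
    sum (map (λ j → ind ⌊ j ∈? xs ⌋) (allFin n))     ≤⟨ sum-map-mono {f = λ j → ind ⌊ j ∈? xs ⌋} (allFin n) (λ j _ → pointwise j) ⟩
    sum (map (λ j → ind ⌊ j ∈? L ⌋) (allFin n))      ≡⟨ count-members L uL ⟩
    length L                                         ∎
    where
    open ≤-Reasoning
    pointwise : ∀ j → ind ⌊ j ∈? xs ⌋ ≤ ind ⌊ j ∈? L ⌋
    pointwise j with j ∈? xs | j ∈? L
    ... | yes j∈xs | no j∉L = ⊥-elim (j∉L (xs⊆L j∈xs))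
    ... | yes _    | yes _  = ≤-refl
    ... | no  _    | _      = z≤n

handshake : ∀ {n} (H : Graph n) → sum (map (deg H) (allFin n)) ≡ edges H + edges H
handshake {n} H = begin
  sum (map (λ i → sum (map (λ j → ind (adj H i j)) (allFin n))) (allFin n))
    ≡⟨ sum-map-cong (allFin n) (λ i _ →
         trans (sum-map-cong (allFin n) (λ j _ → split i j)) (sum-map-+ (below i) (flip below i) (allFin n))) ⟩
  sum (map (λ i → sum (map (below i) (allFin n)) + sum (map (flip below i) (allFin n))) (allFin n))
    ≡⟨ sum-map-+ (λ i → sum (map (below i) (allFin n))) (λ i → sum (map (flip below i) (allFin n))) (allFin n) ⟩
  edges H + sum (map (λ i → sum (map (flip below i) (allFin n))) (allFin n))
    ≡⟨ cong (edges H +_) (sum-swap (flip below) (allFin n) (allFin n)) ⟩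
  edges H + edges H ∎
  where
  open ≡-Reasoning
  below : Fin n → Fin n → ℕ
  below i j = ind (⌊ i Fin.<? j ⌋ ∧ adj H i j)
  split : ∀ i j → ind (adj H i j) ≡ below i j + below j i
  split i j rewrite Graph.sym H j i with adj H i j in ij
  ... | false rewrite ∧-zeroʳ ⌊ i Fin.<? j ⌋ | ∧-zeroʳ ⌊ j Fin.<? i ⌋ = refl
  ... | true rewrite ∧-identityʳ ⌊ i Fin.<? j ⌋ | ∧-identityʳ ⌊ j Fin.<? i ⌋
    with FinP.<-cmp i j | i Fin.<? j | j Fin.<? i
  ...   | tri< _ _ _   | yes _   | no _    = refl
  ...   | tri> _ _ _   | no _    | yes _   = refl
  ...   | tri< i<j _ _ | _       | yes j<i = ⊥-elim (FinP.<-asym i<j j<i)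
  ...   | tri< i<j _ _ | no i≮j  | _       = ⊥-elim (i≮j i<j)
  ...   | tri> _ _ j<i | _       | no j≮i  = ⊥-elim (j≮i j<i)
  ...   | tri> _ _ j<i | yes i<j | _       = ⊥-elim (FinP.<-asym i<j j<i)
  ...   | tri≈ _ refl _ | _      | _       with () ← trans (sym ij) (Graph.irrefl H i)

module _ {s : ℕ} where

  allBut : Fin (suc s) → List (Fin (suc s))
  allBut i = map (punchIn i) (allFin s)

  length-allBut : ∀ i → length (allBut i) ≡ s
  length-allBut i = trans (length-map (punchIn i) (allFin s)) (length-allFin s)

  allBut-unique : ∀ i → Unique (allBut i)
  allBut-unique i = Unique.map⁺ (punchIn-injective i _ _) (Unique.allFin⁺ s)

  ∈-allBut⁺ : ∀ {i j} → j ≢ i → j ∈ allBut i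
  ∈-allBut⁺ {i} j≢i =
    subst (_∈ allBut i) (punchIn-punchOut (λ i≡j → j≢i (sym i≡j))) (∈-map⁺ (punchIn i) (∈-allFin _))

  ∈-allBut⁻ : ∀ {i j} → j ∈ allBut i → j ≢ i
  ∈-allBut⁻ {i} j∈ with ∈-map⁻ (punchIn i) j∈
  ... | k , _ , refl = punchInᵢ≢i i k

  allFrom : Fin (suc s) → List (Fin (suc s))
  allFrom i = i ∷ allBut i

  allFrom-unique : ∀ i → Unique (allFrom i)
  allFrom-unique i = All.tabulate (λ j∈ i≡j → ∈-allBut⁻ j∈ (sym i≡j)) ∷ allBut-unique i

module _ {n : ℕ} where

  without : Fin n → List (Fin n) → List (Fin n)
  without a = filter (λ j → ¬? (j ≟ a))

  without-unique : ∀ a {xs} → Unique xs → Unique (without a xs)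
  without-unique a = Unique.filter⁺ (λ j → ¬? (j ≟ a))

  ∈-without⁻ : ∀ {a j xs} → j ∈ without a xs → j ∈ xs × j ≢ a
  ∈-without⁻ {a} = ∈-filter⁻ (λ j → ¬? (j ≟ a))

  length-without : ∀ a xs → Unique xs → length xs ≤ suc (length (without a xs))
  length-without a []       _            = z≤n
  length-without a (x ∷ xs) (x∉xs ∷ uxs) with x ≟ a
  ... | yes refl = s≤s (≤-reflexive (cong length (sym (filter-all (λ j → ¬? (j ≟ x)) x∉xs′))))
    where x∉xs′ = All.map (λ x≢j j≡x → x≢j (sym j≡x)) x∉xs
  ... | no  _    = s≤s (length-without a xs uxs)

linked-join : ∀ {A : Set} {R : A → A → Set} {xs y ys} →
  Linked R xs → All (λ z → R z y) xs → Linked R (y ∷ ys) → Linked R (xs ++ y ∷ ys)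
linked-join []       []       l = l
linked-join [-]      (r ∷ []) l = r ∷ l
linked-join (r ∷ rs) (_ ∷ rs′) l = r ∷ linked-join rs rs′ l

-- Monotone chains whose entries carry a level (later: the degree) and a key
-- (later: the clique).
module _ {A K : Set} (key : A → K) (level : A → ℕ) where

  SameLevelSameKey : A → A → Set
  SameLevelSameKey x y = level x ≡ level y → key x ≡ key y

  -- Along a chain whose levels move monotonically with respect to a partial
  -- order ⊑, and whose steps between equal levels keep the key, any two
  -- entries on the same level have the same key (all entries in between are on
  -- that level too).
  module _ {R : A → A → Set} {_⊑_ : ℕ → ℕ → Set}
           (⊑-trans : ∀ {a b c} → a ⊑ b → b ⊑ c → a ⊑ c)
           (⊑-antisym : ∀ {a b} → a ⊑ b → b ⊑ a → a ≡ b)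
           (monotone : ∀ {x y} → R x y → level x ⊑ level y)
           (step : ∀ {x y} → R x y → SameLevelSameKey x y) where

    private
      above : ∀ {x xs} → Linked R (x ∷ xs) → All (λ z → level x ⊑ level z) xs
      above [-]      = []
      above (r ∷ rs) = monotone r ∷ All.map (⊑-trans (monotone r)) (above rs)

      fromHead : ∀ {x xs} → Linked R (x ∷ xs) → All (SameLevelSameKey x) xs
      fromHead [-]      = []
      fromHead {x} {y ∷ _} (r ∷ rs) = step r ∷ All.zipWith later (above rs , fromHead rs)
        where
        later : ∀ {z} → level y ⊑ level z × SameLevelSameKey y z → SameLevelSameKey x z
        later (y⊑z , yz) x≡z =
          let y≡x = ⊑-antisym (subst (level y ⊑_) (sym x≡z) y⊑z) (monotone r)
          in trans (step r (sym y≡x)) (yz (trans y≡x x≡z))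

    level-classes : ∀ {xs} → Linked R xs → AllPairs SameLevelSameKey xs
    level-classes []            = []
    level-classes [-]           = [] ∷ []
    level-classes rs@(_ ∷ rs′) = fromHead rs ∷ level-classes rs′

  module _ (m : ℕ)
           (class-bound : ∀ κ ys → Unique ys → All (λ y → key y ≡ κ) ys → length ys ≤ m) where

    private
      one-level-bound : ∀ {a ys} → Unique ys → All (λ y → level y ≡ a) ys →
        AllPairs SameLevelSameKey ys → length ys ≤ m
      one-level-bound {ys = []}     _ _            _            = z≤n
      one-level-bound {ys = y ∷ ys} u (ly ∷ lys) (y-ys ∷ _) =
        class-bound (key y) (y ∷ ys) u
          (refl ∷ All.zipWith (λ (yz , lz) → sym (yz (trans ly (sym lz)))) (y-ys , lys))

      length-split : ∀ {P : A → Set} (P? : ∀ x → Dec (P x)) xs →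
        length xs ≡ length (filter P? xs) + length (filter (λ x → ¬? (P? x)) xs)
      length-split P? []       = refl
      length-split P? (x ∷ xs) with P? x
      ... | yes _ = cong suc (length-split P? xs)
      ... | no  _ = trans (cong suc (length-split P? xs)) (sym (+-suc _ _))

    two-level-bound : ∀ {a b xs} → Unique xs → All (λ x → level x ≡ a ⊎ level x ≡ b) xs →
      AllPairs SameLevelSameKey xs → length xs ≤ m + m
    two-level-bound {a} {b} {xs} u levels same = begin
      length xs                                ≡⟨ length-split onA xs ⟩
      length (filter onA xs) + length (filter offA xs)
        ≤⟨ +-mono-≤ (one-level-bound (Unique.filter⁺ onA u) (All.all-filter onA xs) (AllPairs.filter⁺ onA same))
                    (one-level-bound (Unique.filter⁺ offA u) (All.zipWith notA (All.all-filter offA xs , All.filter⁺ offA levels)) (AllPairs.filter⁺ offA same)) ⟩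
      m + m ∎
      where
      open ≤-Reasoning
      onA = λ x → level x ℕ.≟ a
      offA = λ x → ¬? (onA x)
      notA : ∀ {x} → ¬ (level x ≡ a) × (level x ≡ a ⊎ level x ≡ b) → level x ≡ b
      notA (≢a , inj₁ ≡a) = ⊥-elim (≢a ≡a)
      notA (_  , inj₂ ≡b) = ≡b

module _ {n : ℕ} where

  ≟-refl : (a : Fin n) → ⌊ a ≟ a ⌋ ≡ true
  ≟-refl a with a ≟ a
  ... | yes _   = refl
  ... | no  a≢a = ⊥-elim (a≢a refl)

  ≟-false : ∀ {a b : Fin n} → a ≢ b → ⌊ a ≟ b ⌋ ≡ false
  ≟-false {a} {b} a≢b with a ≟ b
  ... | yes a≡b = ⊥-elim (a≢b a≡b)
  ... | no  _   = refl

  ≟-true : ∀ {a b : Fin n} → ⌊ a ≟ b ⌋ ≡ true → a ≡ b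
  ≟-true {a} {b} e with a ≟ b
  ... | yes a≡b = a≡b

record AddsEdge {n} (G H : Graph n) (u v : Fin n) : Set where
  field
    distinct       : u ≢ v
    keeps          : ∀ x y → adj G x y ≡ true → adj H x y ≡ true
    joins          : adj H u v ≡ true
    degree-formula : ∀ x → deg H x ≡ deg G x + ind ⌊ x ≟ u ⌋ + ind ⌊ x ≟ v ⌋

  degree-untouched : ∀ x → x ≢ u → x ≢ v → deg H x ≡ deg G x
  degree-untouched x x≢u x≢v = begin
    deg H x                                  ≡⟨ degree-formula x ⟩
    deg G x + ind ⌊ x ≟ u ⌋ + ind ⌊ x ≟ v ⌋  ≡⟨ cong₂ (λ a b → deg G x + ind a + ind b) (≟-false x≢u) (≟-false x≢v) ⟩
    deg G x + 0 + 0                          ≡⟨ trans (+-identityʳ _) (+-identityʳ _) ⟩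
    deg G x                                  ∎
    where open ≡-Reasoning

  degree-grows : ∀ x → deg G x ≤ deg H x
  degree-grows x = ≤-trans (≤-trans (m≤m+n _ _) (m≤m+n _ _)) (≤-reflexive (sym (degree-formula x)))

  degree-u : deg H u ≡ deg G u + 1
  degree-u = begin
    deg H u                                  ≡⟨ degree-formula u ⟩
    deg G u + ind ⌊ u ≟ u ⌋ + ind ⌊ u ≟ v ⌋  ≡⟨ cong₂ (λ a b → deg G u + ind a + ind b) (≟-refl u) (≟-false distinct) ⟩
    deg G u + 1 + 0                          ≡⟨ +-identityʳ _ ⟩
    deg G u + 1                              ∎
    where open ≡-Reasoning

  degree-v : deg H v ≡ deg G v + 1
  degree-v = begin
    deg H v                                  ≡⟨ degree-formula v ⟩
    deg G v + ind ⌊ v ≟ u ⌋ + ind ⌊ v ≟ v ⌋  ≡⟨ cong₂ (λ a b → deg G v + ind a + ind b) (≟-false (λ v≡u → distinct (sym v≡u))) (≟-refl v) ⟩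
    deg G v + 0 + 1                          ≡⟨ cong (_+ 1) (+-identityʳ _) ⟩
    deg G v + 1                              ∎
    where open ≡-Reasoning

AddsEdge-swap : ∀ {n} {G H : Graph n} {u v} → AddsEdge G H u v → AddsEdge G H v u
AddsEdge-swap {G = G} {H} {u} {v} e = record
  { distinct       = λ v≡u → distinct (sym v≡u)
  ; keeps          = keeps
  ; joins          = trans (Graph.sym H v u) joins
  ; degree-formula = λ x → trans (degree-formula x) (trans (+-assoc (deg G x) _ _)
      (trans (cong (deg G x +_) (+-comm (ind ⌊ x ≟ u ⌋) _)) (sym (+-assoc (deg G x) _ _))))
  }
  where open AddsEdge e

private
  ind-exclusive-∨ : ∀ a b c → (b ≡ true → a ≡ false) → (c ≡ true → a ≡ false) →
    (b ≡ true → c ≡ true → ⊥) → ind (a ∨ (b ∨ c)) ≡ ind a + ind b + ind c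
  ind-exclusive-∨ false false false _   _   _  = refl
  ind-exclusive-∨ false false true  _   _   _  = refl
  ind-exclusive-∨ false true  false _   _   _  = refl
  ind-exclusive-∨ false true  true  _   _   bc = ⊥-elim (bc refl refl)
  ind-exclusive-∨ true  false false _   _   _  = refl
  ind-exclusive-∨ true  true  _     b⇒¬a _   _  with () ← b⇒¬a refl
  ind-exclusive-∨ true  false true  _   c⇒¬a _  with () ← c⇒¬a refl

  sum-ind-∧-≟ : ∀ {n} b (w : Fin n) → sum (map (λ j → ind (b ∧ ⌊ j ≟ w ⌋)) (allFin n)) ≡ ind b
  sum-ind-∧-≟ {n} false w = sum-map-zero (allFin n)
  sum-ind-∧-≟ {n} true  w = occurrences-allFin w

  ∧-true : ∀ {a b} → (a ∧ b) ≡ true → a ≡ true × b ≡ true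
  ∧-true {true} {true} _ = refl , refl

addEdge-adds : ∀ {n} (G : Graph n) u v (u≢v : u ≢ v) → adj G u v ≡ false →
  AddsEdge G (addEdge G u v u≢v) u v
addEdge-adds {n} G u v u≢v uv∉G = record
  { distinct       = u≢v
  ; keeps          = λ x y xy∈G → cong (_∨ _) xy∈G
  ; joins          = joins
  ; degree-formula = degree-formula
  }
  where
  H = addEdge G u v u≢v
  joins : adj H u v ≡ true
  joins = begin
    adj G u v ∨ ((⌊ u ≟ u ⌋ ∧ ⌊ v ≟ v ⌋) ∨ (⌊ u ≟ v ⌋ ∧ ⌊ v ≟ u ⌋))
      ≡⟨ cong₂ (λ a b → adj G u v ∨ ((a ∧ b) ∨ (⌊ u ≟ v ⌋ ∧ ⌊ v ≟ u ⌋))) (≟-refl u) (≟-refl v) ⟩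
    adj G u v ∨ true
      ≡⟨ ∨-zeroʳ (adj G u v) ⟩
    true ∎
    where open ≡-Reasoning
  split : ∀ x j → ind (adj H x j) ≡
    ind (adj G x j) + ind (⌊ x ≟ u ⌋ ∧ ⌊ j ≟ v ⌋) + ind (⌊ x ≟ v ⌋ ∧ ⌊ j ≟ u ⌋)
  split x j = ind-exclusive-∨ (adj G x j) (⌊ x ≟ u ⌋ ∧ ⌊ j ≟ v ⌋) (⌊ x ≟ v ⌋ ∧ ⌊ j ≟ u ⌋)
    (λ e → let (x≡u , j≡v) = ∧-true e in subst₂ (λ x j → adj G x j ≡ false) (sym (≟-true x≡u)) (sym (≟-true j≡v)) uv∉G)
    (λ e → let (x≡v , j≡u) = ∧-true e in subst₂ (λ x j → adj G x j ≡ false) (sym (≟-true x≡v)) (sym (≟-true j≡u)) (trans (Graph.sym G v u) uv∉G))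
    (λ e e′ → u≢v (trans (sym (≟-true (proj₁ (∧-true {⌊ x ≟ u ⌋} e)))) (≟-true (proj₁ (∧-true {⌊ x ≟ v ⌋} e′)))))
  degree-formula : ∀ x → deg H x ≡ deg G x + ind ⌊ x ≟ u ⌋ + ind ⌊ x ≟ v ⌋
  degree-formula x = begin
    sum (map (λ j → ind (adj H x j)) (allFin n))
      ≡⟨ sum-map-cong (allFin n) (λ j _ → split x j) ⟩
    sum (map (λ j → ind (adj G x j) + fromU j + fromV j) (allFin n))
      ≡⟨ sum-map-+ (λ j → ind (adj G x j) + fromU j) fromV (allFin n) ⟩
    sum (map (λ j → ind (adj G x j) + fromU j) (allFin n)) + sum (map fromV (allFin n))
      ≡⟨ cong (_+ sum (map fromV (allFin n))) (sum-map-+ (λ j → ind (adj G x j)) fromU (allFin n)) ⟩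
    deg G x + sum (map fromU (allFin n)) + sum (map fromV (allFin n))
      ≡⟨ cong₂ (λ a b → deg G x + a + b) (sum-ind-∧-≟ {n} ⌊ x ≟ u ⌋ v) (sum-ind-∧-≟ {n} ⌊ x ≟ v ⌋ u) ⟩
    deg G x + ind ⌊ x ≟ u ⌋ + ind ⌊ x ≟ v ⌋ ∎
    where
    open ≡-Reasoning
    fromU fromV : Fin n → ℕ
    fromU j = ind (⌊ x ≟ u ⌋ ∧ ⌊ j ≟ v ⌋)
    fromV j = ind (⌊ x ≟ v ⌋ ∧ ⌊ j ≟ u ⌋)

Part : Set
Part = Fin 3

left middle right : Part
left   = zero
middle = suc zero
right  = suc (suc zero)

isMiddle : Part → Bool
isMiddle p = ⌊ p ≟ middle ⌋

part-view : ∀ p → isMiddle p ≡ false ⊎ p ≡ middle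
part-view zero             = inj₁ refl
part-view (suc zero)       = inj₂ refl
part-view (suc (suc zero)) = inj₁ refl

outer≢middle : ∀ {p} → isMiddle p ≡ false → p ≢ middle
outer≢middle o refl with () ← o

-- The parts matched to p by a perfect matching: the middle clique is
-- matched to both outer cliques.
matchedParts : Part → List Part
matchedParts zero             = middle ∷ []
matchedParts (suc zero)       = left ∷ right ∷ []
matchedParts (suc (suc zero)) = middle ∷ []

matchedParts-unique : ∀ p → Unique (matchedParts p)
matchedParts-unique zero             = [] ∷ []
matchedParts-unique (suc zero)       = ((λ ()) ∷ []) ∷ [] ∷ []
matchedParts-unique (suc (suc zero)) = [] ∷ []

length-matchedParts : ∀ p → length (matchedParts p) ≡ suc (ind (isMiddle p))
length-matchedParts zero             = refl
length-matchedParts (suc zero)       = refl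
length-matchedParts (suc (suc zero)) = refl

∈-matchedParts⁺ : ∀ {p p′} → p ≢ p′ → (isMiddle p ∨ isMiddle p′) ≡ true → p′ ∈ matchedParts p
∈-matchedParts⁺ {zero}             {zero}             p≢p _ = ⊥-elim (p≢p refl)
∈-matchedParts⁺ {zero}             {suc zero}         _   _ = here refl
∈-matchedParts⁺ {suc zero}         {zero}             _   _ = here refl
∈-matchedParts⁺ {suc zero}         {suc zero}         p≢p _ = ⊥-elim (p≢p refl)
∈-matchedParts⁺ {suc zero}         {suc (suc zero)}   _   _ = there (here refl)
∈-matchedParts⁺ {suc (suc zero)}   {suc zero}         _   _ = here refl
∈-matchedParts⁺ {suc (suc zero)}   {suc (suc zero)}   p≢p _ = ⊥-elim (p≢p refl)

∈-matchedParts⁻ : ∀ {p p′} → p′ ∈ matchedParts p → p ≢ p′ × (isMiddle p ∨ isMiddle p′) ≡ true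
∈-matchedParts⁻ {zero}           (here refl)         = (λ ()) , refl
∈-matchedParts⁻ {suc zero}       (here refl)         = (λ ()) , refl
∈-matchedParts⁻ {suc zero}       (there (here refl)) = (λ ()) , refl
∈-matchedParts⁻ {suc (suc zero)} (here refl)         = (λ ()) , refl

-- Vertex (b , p , i) is the i-th vertex
-- of clique p in block b; `encode` numbers the vertices by Fin N.
module Construction (s q : ℕ) where

  t N : ℕ
  t = suc s
  N = q * (3 * t)

  Vertex : Set
  Vertex = Fin q × Part × Fin t

  encode : Vertex → Fin N
  encode (b , p , i) = combine b (combine p i)

  decode : Fin N → Vertex
  decode x = proj₁ (remQuot (3 * t) x) , remQuot t (proj₂ (remQuot {q} (3 * t) x))

  decode-encode : ∀ x → decode (encode x) ≡ x
  decode-encode (b , p , i) =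
    trans (cong (λ r → proj₁ r , remQuot t (proj₂ r)) (remQuot-combine b (combine p i)))
          (cong (b ,_) (remQuot-combine p i))

  encode-decode : ∀ x → encode (decode x) ≡ x
  encode-decode x =
    trans (cong (combine (proj₁ (decode x))) (combine-remQuot {3} t (proj₂ (remQuot {q} (3 * t) x))))
          (combine-remQuot {q} (3 * t) x)

  encode-injective : ∀ {x y} → encode x ≡ encode y → x ≡ y
  encode-injective {x} {y} e = trans (sym (decode-encode x)) (trans (cong decode e) (decode-encode y))

  block : Vertex → Fin q
  block (b , _ , _) = b
  part : Vertex → Part
  part (_ , p , _) = p
  index : Vertex → Fin t
  index (_ , _ , i) = i

  clique : Vertex → Fin q × Part
  clique (b , p , _) = b , p

  run : Fin q → Part → List (Fin t) → List Vertex
  run b p = map (λ i → b , p , i)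

  run-unique : ∀ b p {L} → Unique L → Unique (run b p L)
  run-unique b p = Unique.map⁺ (cong index)

  ∈-run⁻ : ∀ {b p L y} → y ∈ run b p L → ∃[ j ] (j ∈ L × y ≡ (b , p , j))
  ∈-run⁻ = ∈-map⁻ _

  ∉-run-part : ∀ {y b p L} → part y ≢ p → y ∉ run b p L
  ∉-run-part y≢p y∈ with ∈-run⁻ y∈
  ... | _ , _ , refl = y≢p refl

  -- Adjacency: same clique, or matched (same block and index, one of the
  -- two parts being the middle one).
  edge : Vertex → Vertex → Bool
  edge (b , p , i) (b′ , p′ , i′) = ⌊ b ≟ b′ ⌋ ∧
    (if ⌊ p ≟ p′ ⌋ then not ⌊ i ≟ i′ ⌋ else (⌊ i ≟ i′ ⌋ ∧ (isMiddle p ∨ isMiddle p′)))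

  edge-sym : ∀ x y → edge x y ≡ edge y x
  edge-sym (b , p , i) (b′ , p′ , i′)
    with b ≟ b′ | b′ ≟ b | p ≟ p′ | p′ ≟ p | i ≟ i′ | i′ ≟ i
  ... | no _     | no _     | _        | _        | _        | _        = refl
  ... | yes refl | no b≢b   | _        | _        | _        | _        = ⊥-elim (b≢b refl)
  ... | no b≢b   | yes refl | _        | _        | _        | _        = ⊥-elim (b≢b refl)
  ... | yes _    | yes _    | yes refl | no p≢p   | _        | _        = ⊥-elim (p≢p refl)
  ... | yes _    | yes _    | no p≢p   | yes refl | _        | _        = ⊥-elim (p≢p refl)
  ... | yes _    | yes _    | _        | _        | yes refl | no i≢i   = ⊥-elim (i≢i refl)
  ... | yes _    | yes _    | _        | _        | no i≢i   | yes refl = ⊥-elim (i≢i refl)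
  ... | yes _    | yes _    | yes _    | yes _    | yes _    | yes _    = refl
  ... | yes _    | yes _    | yes _    | yes _    | no _     | no _     = refl
  ... | yes _    | yes _    | no _     | no _     | yes _    | yes _    = ∨-comm (isMiddle p) (isMiddle p′)
  ... | yes _    | yes _    | no _     | no _     | no _     | no _     = refl

  edge-irreflexive : ∀ x → edge x x ≡ false
  edge-irreflexive (b , p , i) rewrite ≟-refl b | ≟-refl p | ≟-refl i = refl

  G : Graph N
  G = record
    { adj    = λ x y → edge (decode x) (decode y)
    ; sym    = λ x y → edge-sym (decode x) (decode y)
    ; irrefl = λ x → edge-irreflexive (decode x)
    }

  adj-encode : ∀ x y → adj G (encode x) (encode y) ≡ edge x y
  adj-encode x y = cong₂ edge (decode-encode x) (decode-encode y)

  edge-clique : ∀ b p {i i′} → i ≢ i′ → edge (b , p , i) (b , p , i′) ≡ true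
  edge-clique b p i≢i′ rewrite ≟-refl b | ≟-refl p | ≟-false i≢i′ = refl

  edge-matched : ∀ b {p p′} i → p ≢ p′ → (isMiddle p ∨ isMiddle p′) ≡ true →
    edge (b , p , i) (b , p′ , i) ≡ true
  edge-matched b i p≢p′ m rewrite ≟-refl b | ≟-false p≢p′ | ≟-refl i = m

  edge-inversion : ∀ {b p i b′ p′ i′} → edge (b , p , i) (b′ , p′ , i′) ≡ true →
    b ≡ b′ × ((p ≡ p′ × i ≢ i′) ⊎ (p ≢ p′ × i ≡ i′ × (isMiddle p ∨ isMiddle p′) ≡ true))
  edge-inversion {b} {p} {i} {b′} {p′} {i′} e with b ≟ b′ | p ≟ p′ | i ≟ i′
  ... | yes b≡b′ | yes p≡p′ | no i≢i′  = b≡b′ , inj₁ (p≡p′ , i≢i′)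
  ... | yes b≡b′ | no p≢p′  | yes i≡i′ = b≡b′ , inj₂ (p≢p′ , i≡i′ , e)
  ... | no _     | _        | _        with () ← e
  ... | yes _    | yes _    | yes _    with () ← e
  ... | yes _    | no _     | no _     with () ← e

  partDegree : Part → ℕ
  partDegree p = t + ind (isMiddle p)

  neighbours : Vertex → List Vertex
  neighbours (b , p , i) = run b p (allBut i) ++ map (λ p′ → b , p′ , i) (matchedParts p)

  neighbours-unique : ∀ x → Unique (neighbours x)
  neighbours-unique (b , p , i) =
    Unique.++⁺ (run-unique b p (allBut-unique i))
               (Unique.map⁺ (cong part) (matchedParts-unique p))
               apart
    where
    apart : ∀ {y} → ¬ (y ∈ run b p (allBut i) × y ∈ map (λ p′ → b , p′ , i) (matchedParts p))
    apart (y∈run , y∈partners) with ∈-run⁻ y∈run | ∈-map⁻ _ y∈partners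
    ... | _ , _ , refl | _ , p′∈ , e = proj₁ (∈-matchedParts⁻ p′∈) (cong part e)

  neighbours-complete : ∀ x y → edge x y ≡ true → y ∈ neighbours x
  neighbours-complete (b , p , i) (b′ , p′ , i′) e with edge-inversion {b} {p} {i} {b′} {p′} {i′} e
  ... | refl , inj₁ (refl , i≢i′)   = ∈-++⁺ˡ (∈-map⁺ _ (∈-allBut⁺ (λ i′≡i → i≢i′ (sym i′≡i))))
  ... | refl , inj₂ (p≢p′ , refl , m) = ∈-++⁺ʳ _ (∈-map⁺ _ (∈-matchedParts⁺ p≢p′ m))

  neighbours-sound : ∀ x y → y ∈ neighbours x → edge x y ≡ true
  neighbours-sound (b , p , i) y y∈ with ∈-++⁻ (run b p (allBut i)) y∈
  ... | inj₁ y∈run with ∈-run⁻ y∈run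
  ...   | j , j∈ , refl = edge-clique b p (λ i≡j → ∈-allBut⁻ j∈ (sym i≡j))
  neighbours-sound (b , p , i) y y∈ | inj₂ y∈partners with ∈-map⁻ _ y∈partners
  ...   | p′ , p′∈ , refl = edge-matched b i (proj₁ (∈-matchedParts⁻ p′∈)) (proj₂ (∈-matchedParts⁻ p′∈))

  length-neighbours : ∀ b p i → length (neighbours (b , p , i)) ≡ partDegree p
  length-neighbours b p i = begin
    length (neighbours (b , p , i))
      ≡⟨ length-++ (run b p (allBut i)) ⟩
    length (run b p (allBut i)) + length (map (λ p′ → b , p′ , i) (matchedParts p))
      ≡⟨ cong₂ _+_ (trans (length-map _ (allBut i)) (length-allBut i)) (length-map _ (matchedParts p)) ⟩
    s + length (matchedParts p)
      ≡⟨ trans (cong (s +_) (length-matchedParts p)) (+-suc s _) ⟩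
    partDegree p ∎
    where open ≡-Reasoning

  degree-encode : ∀ b p i → deg G (encode (b , p , i)) ≡ partDegree p
  degree-encode b p i =
    trans (count-by-list (adj G x̂) (map encode (neighbours x))
                         (Unique.map⁺ encode-injective (neighbours-unique x)) complete sound)
          (trans (length-map encode (neighbours x)) (length-neighbours b p i))
    where
    x = (b , p , i)
    x̂ = encode x
    complete : ∀ y → adj G x̂ y ≡ true → y ∈ map encode (neighbours x)
    complete y e = subst (_∈ map encode (neighbours x)) (encode-decode y)
      (∈-map⁺ encode (neighbours-complete x (decode y) (trans (cong (λ z → edge z (decode y)) (sym (decode-encode x))) e)))
    sound : ∀ y → y ∈ map encode (neighbours x) → adj G x̂ y ≡ true
    sound y y∈ with ∈-map⁻ encode y∈
    ... | z , z∈ , refl = trans (adj-encode x z) (neighbours-sound x z z∈)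

  degree : ∀ x → deg G x ≡ partDegree (part (decode x))
  degree x = trans (cong (deg G) (sym (encode-decode x))) (degree-encode _ _ _)

  middleVertex : Fin (q * t) → Vertex
  middleVertex r = proj₁ (remQuot {q} t r) , middle , proj₂ (remQuot {q} t r)

  middles : List (Fin N)
  middles = map (λ r → encode (middleVertex r)) (allFin (q * t))

  count-middle : sum (map (λ x → ind (isMiddle (part (decode x)))) (allFin N)) ≡ q * t
  count-middle =
    trans (count-by-list (λ x → isMiddle (part (decode x))) middles
                         (Unique.map⁺ injective (Unique.allFin⁺ (q * t))) complete sound)
          (trans (length-map _ (allFin (q * t))) (length-allFin (q * t)))
    where
    injective : ∀ {r r′} → encode (middleVertex r) ≡ encode (middleVertex r′) → r ≡ r′
    injective {r} {r′} e = trans (sym (combine-remQuot {q} t r))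
      (trans (cong (λ x → combine (block x) (index x)) (encode-injective {middleVertex r} {middleVertex r′} e)) (combine-remQuot {q} t r′))
    complete : ∀ x → isMiddle (part (decode x)) ≡ true → x ∈ middles
    complete x m = subst (_∈ middles) is-x (∈-map⁺ _ (∈-allFin (combine b i)))
      where
      b = block (decode x)
      i = index (decode x)
      is-x : encode (middleVertex (combine b i)) ≡ x
      is-x = trans (cong (λ r → encode (proj₁ r , middle , proj₂ r)) (remQuot-combine {q} b i))
                   (trans (cong (λ p → encode (b , p , i)) (sym (≟-true m))) (encode-decode x))
    sound : ∀ x → x ∈ middles → isMiddle (part (decode x)) ≡ true
    sound x x∈ with ∈-map⁻ _ x∈
    ... | r , _ , refl = cong (λ y → isMiddle (part y)) (decode-encode (middleVertex r))

  -- Twice the number of edges: t per vertex plus one per middle vertex.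
  sum-degrees : sum (map (deg G) (allFin N)) ≡ N * t + q * t
  sum-degrees = begin
    sum (map (deg G) (allFin N))
      ≡⟨ sum-map-cong (allFin N) (λ x _ → degree x) ⟩
    sum (map (λ x → t + ind (isMiddle (part (decode x)))) (allFin N))
      ≡⟨ sum-map-+ (λ _ → t) (λ x → ind (isMiddle (part (decode x)))) (allFin N) ⟩
    sum (map (λ _ → t) (allFin N)) + sum (map (λ x → ind (isMiddle (part (decode x)))) (allFin N))
      ≡⟨ cong₂ _+_ (trans (sum-map-const t (allFin N)) (cong (_* t) (length-allFin N))) count-middle ⟩
    N * t + q * t ∎
    where open ≡-Reasoning

  edge-count : 12 * edges G ≡ N * (3 * suc (t + t) ∸ 1)
  edge-count = begin
    12 * edges G                ≡⟨ solve 1 (λ e → con 12 :* e := con 6 :* (e :+ e)) refl (edges G) ⟩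
    6 * (edges G + edges G)     ≡⟨ cong (6 *_) (trans (sym (handshake G)) sum-degrees) ⟩
    6 * (N * t + q * t)         ≡⟨ solve 2 (λ q t → con 6 :* ((q :* (con 3 :* t)) :* t :+ q :* t)
                                      := (q :* (con 3 :* t)) :* ((t :+ t) :+ ((con 1 :+ (t :+ t)) :+ ((con 1 :+ (t :+ t)) :+ con 0))))
                                      refl q t ⟩
    N * (3 * suc (t + t) ∸ 1)   ∎
    where
    open ≡-Reasoning
    open +-*-Solver

  -- Adjacent vertices of equal degree lie in the same clique: a matching
  -- edge joins a middle vertex (degree t + 1) to an outer one (degree t).
  equal-degree-same-clique : ∀ x y → edge x y ≡ true →
    partDegree (part x) ≡ partDegree (part y) → clique x ≡ clique y
  equal-degree-same-clique (b , p , i) (b′ , p′ , i′) e same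
    with edge-inversion {b} {p} {i} {b′} {p′} {i′} e
  ... | refl , inj₁ (refl , _)       = refl
  ... | refl , inj₂ (p≢p′ , _ , m) = ⊥-elim (p≢p′ (trans (≟-true p-middle) (sym (≟-true p′-middle))))
    where
    same-side : isMiddle p ≡ isMiddle p′
    same-side = ind-injective (+-cancelˡ-≡ t _ _ same)
    p-middle : isMiddle p ≡ true
    p-middle = both-true same-side m
      where
      both-true : ∀ {a b} → a ≡ b → (a ∨ b) ≡ true → a ≡ true
      both-true {true}  _    _  = refl
      both-true {false} refl ()
    p′-middle : isMiddle p′ ≡ true
    p′-middle = trans (sym same-side) p-middle

  clique-size : ∀ κ ys → Unique ys → All (λ y → clique (decode y) ≡ κ) ys → length ys ≤ t
  clique-size (b , p) ys uys in-κ =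
    ≤-trans (subset-length ys (map encode (run b p (allFin t))) uys
                           (Unique.map⁺ encode-injective (run-unique b p (Unique.allFin⁺ t))) ⊆κ)
            (≤-reflexive (trans (length-map encode (run b p (allFin t))) (trans (length-map _ (allFin t)) (length-allFin t))))
    where
    ⊆κ : ∀ {y} → y ∈ ys → y ∈ map encode (run b p (allFin t))
    ⊆κ {y} y∈ = subst (_∈ map encode (run b p (allFin t)))
      (trans (cong (λ c → encode (proj₁ c , proj₂ c , index (decode y))) (sym (All.lookup in-κ y∈))) (encode-decode y))
      (∈-map⁺ encode (∈-map⁺ _ (∈-allFin _)))

  two-degrees : ∀ x → deg G x ≡ t ⊎ deg G x ≡ t + 1
  two-degrees x with isMiddle (part (decode x)) | degree x
  ... | false | d = inj₁ (trans d (+-identityʳ t))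
  ... | true  | d = inj₂ d

  -- A path of G whose degrees are monotone (for ⊑ = ≤ or ≥) has at most 2t
  -- vertices: those of each degree stay inside one clique.
  monotone-path-bound : ∀ {_⊑_ : ℕ → ℕ → Set} →
    (∀ {a b c} → a ⊑ b → b ⊑ c → a ⊑ c) → (∀ {a b} → a ⊑ b → b ⊑ a → a ≡ b) →
    ∀ {xs} → Unique xs → Linked (λ x y → adj G x y ≡ true × deg G x ⊑ deg G y) xs →
    length xs ≤ t + t
  monotone-path-bound ⊑-trans ⊑-antisym {xs} unique path =
    two-level-bound key (deg G) t clique-size unique (All.tabulate (λ {x} _ → two-degrees x))
      (level-classes key (deg G) ⊑-trans ⊑-antisym proj₂ step path)
    where
    key : Fin N → Fin q × Part
    key x = clique (decode x)
    step : ∀ {x y} → adj G x y ≡ true × _ → SameLevelSameKey key (deg G) x y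
    step {x} {y} (e , _) same =
      equal-degree-same-clique (decode x) (decode y) e (trans (sym (degree x)) (trans same (degree y)))

  mp-bound : MpLt G (suc (t + t))
  mp-bound p ((unique , adjacent) , inj₁ ascending) =
    s≤s (monotone-path-bound ≤-trans ≤-antisym unique (Linked.zip (adjacent , ascending)))
  mp-bound p ((unique , adjacent) , inj₂ descending) =
    s≤s (monotone-path-bound (λ ab bc → ≤-trans bc ab) (λ ba ab → ≤-antisym ab ba) unique
                             (Linked.zip (adjacent , descending)))

  opposite : Part → Part
  opposite zero             = right
  opposite (suc zero)       = middle
  opposite (suc (suc zero)) = left

  opposite-outer : ∀ {p} → isMiddle p ≡ false → isMiddle (opposite p) ≡ false × opposite p ≢ p
  opposite-outer {zero}           _ = refl , (λ ())
  opposite-outer {suc (suc zero)} _ = refl , (λ ())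

  -- They are
  -- built as lists of vertices of G along which the degree in H does not
  -- decrease; most of their vertices are untouched by the new edge.
  module AfterAdding {H : Graph N} {ũ ṽ : Vertex} (added : AddsEdge G H (encode ũ) (encode ṽ)) where

    open AddsEdge added

    k : ℕ
    k = suc (t + t)

    Step : Vertex → Vertex → Set
    Step x y = adj H (encode x) (encode y) ≡ true × deg H (encode x) ≤ deg H (encode y)

    ascending-path : ∀ xs → Unique xs → Linked Step xs → k ≤ length xs → MpGe H k
    ascending-path xs unique steps long =
      map encode xs ,
      ((Unique.map⁺ encode-injective unique , Linked.map⁺ (Linked.map proj₁ steps)) ,
       inj₁ (Linked.map⁺ (Linked.map proj₂ steps))) ,
      subst (k ≤_) (sym (length-map encode xs)) long

    Untouched : Vertex → Set
    Untouched x = x ≢ ũ × x ≢ ṽ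

    untouched-degree : ∀ {b p i} → Untouched (b , p , i) → deg H (encode (b , p , i)) ≡ partDegree p
    untouched-degree {b} {p} {i} (≢ũ , ≢ṽ) =
      trans (degree-untouched _ (λ e → ≢ũ (encode-injective e)) (λ e → ≢ṽ (encode-injective e)))
            (degree-encode b p i)

    degree-at-least : ∀ b p i → partDegree p ≤ deg H (encode (b , p , i))
    degree-at-least b p i = subst (_≤ deg H (encode (b , p , i))) (degree-encode b p i) (degree-grows _)

    degree-ũ : deg H (encode ũ) ≡ partDegree (part ũ) + 1
    degree-ũ = trans degree-u (cong (_+ 1) (degree-encode _ _ _))

    degree-ṽ : deg H (encode ṽ) ≡ partDegree (part ṽ) + 1
    degree-ṽ = trans degree-v (cong (_+ 1) (degree-encode _ _ _))

    edge-in-H : ∀ x y → edge x y ≡ true → adj H (encode x) (encode y) ≡ true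
    edge-in-H x y e = keeps _ _ (trans (adj-encode x y) e)

    clique-step : ∀ {b p i j} → i ≢ j → Untouched (b , p , i) → Step (b , p , i) (b , p , j)
    clique-step {b} {p} {i} {j} i≢j free =
      edge-in-H (b , p , i) (b , p , j) (edge-clique b p i≢j) ,
      subst (_≤ deg H (encode (b , p , j))) (sym (untouched-degree free)) (degree-at-least b p j)

    matched-step : ∀ {b o i} → isMiddle o ≡ false → Untouched (b , o , i) → Step (b , o , i) (b , middle , i)
    matched-step {b} {o} {i} outer free =
      edge-in-H (b , o , i) (b , middle , i) (edge-matched b i (outer≢middle outer) (cong (_∨ true) outer)) ,
      ≤-trans (≤-reflexive (trans (untouched-degree free) (cong (λ m → t + ind m) outer)))
              (≤-trans (+-monoʳ-≤ t z≤n) (degree-at-least b middle i))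

    run-steps : ∀ b p {L} → Unique L → All (λ j → Untouched (b , p , j)) L → Linked Step (run b p L)
    run-steps b p {[]}         _                  _               = []
    run-steps b p {_ ∷ []}     _                  _               = [-]
    run-steps b p {i ∷ j ∷ L} ((i≢j ∷ _) ∷ uL) (free ∷ frees) = clique-step i≢j free ∷ run-steps b p uL frees

    run-into : ∀ b p {w} L → All (λ j → Untouched (b , p , j) × j ≢ w) L → All (λ z → Step z (b , p , w)) (run b p L)
    run-into b p []      []                     = []
    run-into b p (j ∷ L) ((free , j≢w) ∷ frees) = clique-step j≢w free ∷ run-into b p L frees

    ∉-endpoints : ∀ {y zs} → Untouched y → All (λ z → z ≡ ũ ⊎ z ≡ ṽ) zs → y ∉ zs
    ∉-endpoints (≢ũ , _)  (inj₁ refl ∷ _)  (here refl) = ≢ũ refl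
    ∉-endpoints (_  , ≢ṽ) (inj₂ refl ∷ _)  (here refl) = ≢ṽ refl
    ∉-endpoints free      (_ ∷ ends)       (there y∈)  = ∉-endpoints free ends y∈

    -- The vertex of index `entry L w` is where a climb enters the middle clique.
    entry : List (Fin t) → Fin t → Fin t
    entry []      w = w
    entry (j ∷ _) _ = j

    -- A climb through block b: all of the outer clique o, ending at the entry
    -- index x, then the middle vertices with indices L (entered at x), then
    -- the middle vertex w and a tail made of endpoints of the new edge.
    -- Degrees: t on the outer clique, t + 1 on the middle run, then the top.
    climb : ∀ b o L w tail → isMiddle o ≡ false → (∀ j → Untouched (b , o , j)) →
      Unique L → All (λ j → Untouched (b , middle , j) × j ≢ w) L →
      Linked Step ((b , middle , w) ∷ tail) → Unique ((b , middle , w) ∷ tail) →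
      All (λ y → y ≡ ũ ⊎ y ≡ ṽ) tail → t ≤ length L + length tail → MpGe H k
    climb b o L w tail outer outer-free uL L-free top-steps top-unique ends enough =
      ascending-path path unique steps long
      where
      x = entry L w
      upper = run b middle L ++ (b , middle , w) ∷ tail
      path = run b o (allBut x) ++ (b , o , x) ∷ upper

      steps : Linked Step path
      steps = linked-join (run-steps b o (allBut-unique x) (All.tabulate (λ {j} _ → outer-free j)))
                          (run-into b o (allBut x) (All.tabulate (λ {j} j∈ → outer-free j , ∈-allBut⁻ j∈)))
                          (enter L (linked-join (run-steps b middle uL (All.map proj₁ L-free))
                                                (run-into b middle L L-free) top-steps))
        where
        enter : ∀ L → Linked Step (run b middle L ++ (b , middle , w) ∷ tail) →
          Linked Step ((b , o , entry L w) ∷ run b middle L ++ (b , middle , w) ∷ tail)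
        enter []      l = matched-step outer (outer-free w) ∷ l
        enter (j ∷ _) l = matched-step outer (outer-free j) ∷ l

      L∉top : ∀ {y} → y ∈ run b middle L → y ∉ (b , middle , w) ∷ tail
      L∉top y∈ y∈top with ∈-run⁻ y∈ | All.lookup L-free (proj₁ (proj₂ (∈-run⁻ y∈)))
      L∉top y∈ (here e)  | j , _ , refl | _ , j≢w  = j≢w (cong index e)
      L∉top y∈ (there e) | j , _ , refl | free , _ = ∉-endpoints free ends e

      outer∉upper : ∀ j → (b , o , j) ∉ upper
      outer∉upper j y∈ with ∈-++⁻ (run b middle L) y∈
      ... | inj₁ y∈L          = ∉-run-part (outer≢middle outer) y∈L
      ... | inj₂ (here e)     = outer≢middle outer (cong part e)
      ... | inj₂ (there y∈tl) = ∉-endpoints (outer-free j) ends y∈tl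

      unique : Unique path
      unique = Unique.++⁺ (run-unique b o (allBut-unique x))
        (All.tabulate (λ y∈ e → outer∉upper x (subst (_∈ upper) (sym e) y∈)) ∷
         Unique.++⁺ (run-unique b middle uL) top-unique (λ (y∈L , y∈top) → L∉top y∈L y∈top))
        lower∉
        where
        lower∉ : ∀ {y} → ¬ (y ∈ run b o (allBut x) × y ∈ (b , o , x) ∷ upper)
        lower∉ (y∈ , y∈′) with ∈-run⁻ y∈
        lower∉ (y∈ , here e)   | j , j∈ , refl = ∈-allBut⁻ j∈ (cong index e)
        lower∉ (y∈ , there e)  | j , _ , refl  = outer∉upper j e

      long : k ≤ length path
      long = begin
        suc (suc (s + suc s))                          ≤⟨ s≤s (s≤s (+-monoʳ-≤ s enough)) ⟩
        suc (suc (s + (length L + length tail)))       ≡⟨ cong suc (+-suc s _) ⟨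
        suc (s + suc (length L + length tail))         ≡⟨ +-suc s _ ⟨
        s + suc (suc (length L + length tail))         ≡⟨ cong (λ m → s + suc m) (+-suc (length L) _) ⟨
        s + suc (length L + suc (length tail))         ≡⟨ cong₂ (λ a b → a + suc (b + suc (length tail)))
                                                              (trans (length-map _ (allBut x)) (length-allBut x)) (length-map _ L) ⟨
        length (run b o (allBut x)) + suc (length (run b middle L) + suc (length tail))
                                                       ≡⟨ cong (λ m → length (run b o (allBut x)) + suc m) (length-++ (run b middle L)) ⟨
        length (run b o (allBut x)) + suc (length upper) ≡⟨ length-++ (run b o (allBut x)) ⟨
        length path ∎
        where open ≤-Reasoning

    ũ≢ṽ : ũ ≢ ṽ
    ũ≢ṽ e = distinct (cong encode e)

    -- ũ and ṽ outer, in different cliques: the clique of ũ ending at ũ, then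
    -- ṽ, then the middle clique of ṽ's block starting at the partner of ṽ.
    outer-outer : isMiddle (part ũ) ≡ false → isMiddle (part ṽ) ≡ false → clique ũ ≢ clique ṽ → MpGe H k
    outer-outer ũ-outer ṽ-outer apart = ascending-path path unique steps long
      where
      lower = run (block ũ) (part ũ) (allBut (index ũ))
      upper = run (block ṽ) middle (allFrom (index ṽ))
      path = lower ++ ũ ∷ ṽ ∷ upper
      ũ≢middle = outer≢middle ũ-outer
      ṽ≢middle = outer≢middle ṽ-outer

      lower-free : All (λ j → Untouched (block ũ , part ũ , j) × j ≢ index ũ) (allBut (index ũ))
      lower-free = All.tabulate (λ j∈ →
        ((λ e → ∈-allBut⁻ j∈ (cong index e)) , (λ e → apart (cong clique e))) , ∈-allBut⁻ j∈)
      upper-free : All (λ j → Untouched (block ṽ , middle , j)) (allFrom (index ṽ))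
      upper-free = All.tabulate (λ _ → (λ e → ũ≢middle (sym (cong part e))) , (λ e → ṽ≢middle (sym (cong part e))))

      ũ→ṽ : Step ũ ṽ
      ũ→ṽ = joins , ≤-reflexive (begin
        deg H (encode ũ)                 ≡⟨ degree-ũ ⟩
        t + ind (isMiddle (part ũ)) + 1  ≡⟨ cong (λ m → t + ind m + 1) (trans ũ-outer (sym ṽ-outer)) ⟩
        t + ind (isMiddle (part ṽ)) + 1  ≡⟨ degree-ṽ ⟨
        deg H (encode ṽ)                 ∎)
        where open ≡-Reasoning
      ṽ→partner : Step ṽ (block ṽ , middle , index ṽ)
      ṽ→partner =
        edge-in-H ṽ (block ṽ , middle , index ṽ) (edge-matched (block ṽ) (index ṽ) ṽ≢middle (cong (_∨ true) ṽ-outer)) ,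
        ≤-trans (≤-reflexive (trans degree-ṽ (cong (λ m → t + ind m + 1) ṽ-outer)))
                (≤-trans (≤-reflexive (cong (_+ 1) (+-identityʳ t)))
                         (degree-at-least (block ṽ) middle (index ṽ)))

      steps : Linked Step path
      steps = linked-join (run-steps (block ũ) (part ũ) (allBut-unique (index ũ)) (All.map proj₁ lower-free))
                          (run-into (block ũ) (part ũ) (allBut (index ũ)) lower-free)
                          (ũ→ṽ ∷ ṽ→partner ∷ run-steps (block ṽ) middle (allFrom-unique (index ṽ)) upper-free)

      unique : Unique path
      unique = Unique.++⁺ (run-unique (block ũ) (part ũ) (allBut-unique (index ũ)))
        ((ũ≢ṽ ∷ All.¬Any⇒All¬ upper (∉-run-part ũ≢middle)) ∷
         All.¬Any⇒All¬ upper (∉-run-part ṽ≢middle) ∷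
         run-unique (block ṽ) middle (allFrom-unique (index ṽ)))
        lower∉
        where
        lower∉ : ∀ {y} → ¬ (y ∈ lower × y ∈ ũ ∷ ṽ ∷ upper)
        lower∉ (y∈ , y∈′) with ∈-run⁻ y∈
        lower∉ (y∈ , here e)           | j , j∈ , refl = ∈-allBut⁻ j∈ (cong index e)
        lower∉ (y∈ , there (here e))   | _ , _ , refl  = apart (cong clique e)
        lower∉ (y∈ , there (there e))  | _ , _ , refl  = ∉-run-part ũ≢middle e

      long : k ≤ length path
      long = ≤-reflexive (begin
        suc (suc (s + suc s))        ≡⟨ cong suc (+-suc s (suc s)) ⟨
        suc (s + suc (suc s))        ≡⟨ +-suc s (suc (suc s)) ⟨
        s + suc (suc (suc s))        ≡⟨ cong₂ (λ a b → a + suc (suc b))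
                                          (trans (length-map _ (allBut (index ũ))) (length-allBut (index ũ)))
                                          (trans (length-map _ (allFrom (index ṽ))) (cong suc (length-allBut (index ṽ)))) ⟨
        length lower + suc (suc (length upper)) ≡⟨ length-++ lower ⟨
        length path                  ∎)
        where open ≡-Reasoning

    -- ũ outer and ṽ middle, not partners: climb through ũ's block from the
    -- opposite outer clique, along its middle clique (avoiding ṽ) to the
    -- partner c of ũ, then ũ, then ṽ.
    outer-middle : isMiddle (part ũ) ≡ false → part ṽ ≡ middle →
      (block ũ , index ũ) ≢ (block ṽ , index ṽ) → MpGe H k
    outer-middle ũ-outer ṽ-middle unmatched =
      climb (block ũ) o L (index ũ) (ũ ∷ ṽ ∷ []) o-outer o-free
            (without-unique (index ṽ) (allBut-unique (index ũ))) L-free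
            top-steps top-unique (inj₁ refl ∷ inj₂ refl ∷ []) enough
      where
      o = opposite (part ũ)
      o-outer = proj₁ (opposite-outer ũ-outer)
      ũ≢middle = outer≢middle ũ-outer
      L = without (index ṽ) (allBut (index ũ))
      c = (block ũ , middle , index ũ)

      o-free : ∀ j → Untouched (block ũ , o , j)
      o-free j = (λ e → proj₂ (opposite-outer ũ-outer) (cong part e)) ,
                 (λ e → outer≢middle o-outer (trans (cong part e) ṽ-middle))
      L-free : All (λ j → Untouched (block ũ , middle , j) × j ≢ index ũ) L
      L-free = All.tabulate (λ j∈ →
        ((λ e → ũ≢middle (sym (cong part e))) , (λ e → proj₂ (∈-without⁻ {xs = allBut (index ũ)} j∈) (cong index e))) ,
        ∈-allBut⁻ (proj₁ (∈-without⁻ {xs = allBut (index ũ)} j∈)))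

      c≢ũ : c ≢ ũ
      c≢ũ e = ũ≢middle (sym (cong part e))
      c≢ṽ : c ≢ ṽ
      c≢ṽ e = unmatched (cong (λ y → block y , index y) e)

      top-steps : Linked Step (c ∷ ũ ∷ ṽ ∷ [])
      top-steps =
        (edge-in-H c ũ (edge-matched (block ũ) (index ũ) (λ e → ũ≢middle (sym e)) refl) ,
         ≤-reflexive (begin
           deg H (encode c)                 ≡⟨ untouched-degree (c≢ũ , c≢ṽ) ⟩
           t + 1                            ≡⟨ cong (_+ 1) (+-identityʳ t) ⟨
           t + 0 + 1                        ≡⟨ cong (λ m → t + ind m + 1) ũ-outer ⟨
           t + ind (isMiddle (part ũ)) + 1  ≡⟨ degree-ũ ⟨
           deg H (encode ũ)                 ∎)) ∷
        (joins ,
         ≤-trans (≤-reflexive (trans degree-ũ (cong (λ m → t + ind m + 1) ũ-outer)))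
                 (≤-trans (≤-reflexive (cong (_+ 1) (+-identityʳ t)))
                          (≤-trans (+-monoˡ-≤ 1 (m≤m+n t _)) (≤-reflexive (sym degree-ṽ))))) ∷ [-]
        where open ≡-Reasoning

      top-unique : Unique (c ∷ ũ ∷ ṽ ∷ [])
      top-unique = (c≢ũ ∷ c≢ṽ ∷ []) ∷ (ũ≢ṽ ∷ []) ∷ [] ∷ []

      enough : t ≤ length L + 2
      enough = subst (t ≤_) (+-comm 2 (length L))
        (s≤s (≤-trans (≤-reflexive (sym (length-allBut (index ũ))))
                      (length-without (index ṽ) (allBut (index ũ)) (allBut-unique (index ũ)))))

    -- ũ and ṽ middle, in different blocks: climb through ũ's block from its
    -- left clique, along its middle clique ending at ũ, then ṽ.
    middle-middle : part ũ ≡ middle → part ṽ ≡ middle → block ũ ≢ block ṽ → MpGe H k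
    middle-middle ũ-middle ṽ-middle apart =
      climb (block ũ) left (allBut (index ũ)) (index ũ) (ṽ ∷ []) refl left-free
            (allBut-unique (index ũ)) L-free top-steps top-unique (inj₂ refl ∷ []) enough
      where
      c = (block ũ , middle , index ũ)
      c≡ũ : c ≡ ũ
      c≡ũ = cong (λ p → block ũ , p , index ũ) (sym ũ-middle)

      left-free : ∀ j → Untouched (block ũ , left , j)
      left-free j = (λ e → left≢middle (trans (cong part e) ũ-middle)) ,
                    (λ e → left≢middle (trans (cong part e) ṽ-middle))
        where
        left≢middle : left ≢ middle
        left≢middle ()
      L-free : All (λ j → Untouched (block ũ , middle , j) × j ≢ index ũ) (allBut (index ũ))
      L-free = All.tabulate (λ j∈ →
        ((λ e → ∈-allBut⁻ j∈ (cong index e)) , (λ e → apart (cong block e))) , ∈-allBut⁻ j∈)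

      top-steps : Linked Step (c ∷ ṽ ∷ [])
      top-steps = subst (λ x → Linked Step (x ∷ ṽ ∷ [])) (sym c≡ũ)
        ((joins , ≤-reflexive (trans degree-ũ (trans (cong (λ p → partDegree p + 1) (trans ũ-middle (sym ṽ-middle)))
                                                        (sym degree-ṽ)))) ∷ [-])

      top-unique : Unique (c ∷ ṽ ∷ [])
      top-unique = ((λ e → apart (cong block e)) ∷ []) ∷ [] ∷ []

      enough : t ≤ length (allBut (index ũ)) + 1
      enough = ≤-reflexive (sym (trans (cong (_+ 1) (length-allBut (index ũ))) (+-comm s 1)))

  non-edge-in-clique : ∀ {b p i i′} → edge (b , p , i) (b , p , i′) ≡ false → i ≡ i′
  non-edge-in-clique {b} {p} {i} {i′} non-edge =
    decidable-stable (i ≟ i′) (λ i≢i′ → case trans (sym non-edge) (edge-clique b p i≢i′) of λ ())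

  saturating : ∀ {H} x y → AddsEdge G H (encode x) (encode y) → edge x y ≡ false → MpGe H (suc (t + t))
  saturating (bu , pu , iu) (bv , pv , iv) added non-edge with part-view pu | part-view pv
  ... | inj₁ ou   | inj₁ ov   = AfterAdding.outer-outer added ou ov
    λ { refl → AfterAdding.ũ≢ṽ added (cong (λ i → bu , pu , i) (non-edge-in-clique {bu} {pu} non-edge)) }
  ... | inj₁ ou   | inj₂ refl = AfterAdding.outer-middle added ou refl unmatched
    where
    unmatched : (bu , iu) ≢ (bv , iv)
    unmatched refl with () ← trans (sym non-edge) (edge-matched bu iu (outer≢middle ou) (cong (_∨ true) ou))
  ... | inj₂ refl | inj₁ ov   = AfterAdding.outer-middle (AddsEdge-swap added) ov refl unmatched
    where
    unmatched : (bv , iv) ≢ (bu , iu)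
    unmatched refl with () ← trans (sym non-edge) (edge-matched bu iu (λ e → outer≢middle ov (sym e)) refl)
  ... | inj₂ refl | inj₂ refl = AfterAdding.middle-middle added refl refl
    λ { refl → AfterAdding.ũ≢ṽ added (cong (λ i → bu , middle , i) (non-edge-in-clique {bu} {middle} non-edge)) }

  saturated : Saturated (suc (t + t)) G
  saturated = mp-bound , λ u v u≢v non-edge →
    saturating (decode u) (decode v)
      (subst₂ (AddsEdge G (addEdge G u v u≢v)) (sym (encode-decode u)) (sym (encode-decode v))
              (addEdge-adds G u v u≢v non-edge))
      non-edge

odd-form : ∀ k → 3 ≤ k → k % 2 ≡ 1 → ∃[ s ] (k ≡ suc (suc s + suc s) × (k ∸ 1) / 2 ≡ suc s)
odd-form k 3≤k odd = go (k / 2) refl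
  where
  k≡ : k ≡ suc (k / 2 * 2)
  k≡ = trans (m≡m%n+[m/n]*n k 2) (cong (_+ (k / 2 * 2)) odd)
  go : ∀ h → k / 2 ≡ h → ∃[ s ] (k ≡ suc (suc s + suc s) × (k ∸ 1) / 2 ≡ suc s)
  go zero    h≡ with s≤s () ← ≤-trans 3≤k (≤-reflexive (trans k≡ (cong (λ h → suc (h * 2)) h≡)))
  go (suc s) h≡ =
    s , trans k≡ (cong suc (trans (cong (_* 2) h≡) (trans (*-comm (suc s) 2) (cong (suc s +_) (+-identityʳ (suc s)))))) ,
        trans (cong (λ m → (m ∸ 1) / 2) k≡) (trans (m*n/n≡m (k / 2) 2) h≡)

theorem2p5 : ∀ (k n : ℕ) → 3 ≤ k → k % 2 ≡ 1 → 0 < n → (3 * ((k ∸ 1) / 2)) ∣ n →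
    ∃[ G ] (Saturated {n} k G × 12 * edges G ≤ n * (3 * k ∸ 1))
theorem2p5 k n 3≤k odd _ (divides q n≡q·3t) with odd-form k 3≤k odd
... | s , refl , t≡ =
  subst (λ n → ∃[ G ] (Saturated {n} k G × 12 * edges G ≤ n * (3 * k ∸ 1)))
        (sym (trans n≡q·3t (cong (λ t → q * (3 * t)) t≡)))
        (G , saturated , ≤-reflexive edge-count)
  where open Construction s q
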